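{- Let $D$ be a $\langle 2,2\rangle$ digraph, $G=CCE(D)$ and $m\ge 3$ an integer. If $P_{v,m}=v_1v_2\cdots v_m$ is a path in $G$, then: (i) $v^-_{i,i+1}\neq v^-_{j,j+1}$ and $v^+_{i,i+1}\ne v^+_{j,j+1}$ for distinct $i,j\in\{1,\ldots,m-1\}$; (ii) for each $2\le i\le m-2$, every neighbor of $v^-_{i,i+1}$ in $G$ is $v^-_{i-1,i}$ or $v^-_{i+1,i+2}$; (iii) for each $2\le i\le m-2$, every neighbor of $v^+_{i,i+1}$ in $G$ is $v^+_{i-1,i}$ or $v^+_{i+1,i+2}$. If $C_{v,m}=v_1v_2\cdots v_mv_1$ is a cycle in $G$ (indices taken modulo $m$), then: (i) $v^-_{i,i+1}\neq v^-_{j,j+1}$ and $v^+_{i,i+1}\ne v^+_{j,j+1}$ for distinct $i,j\in\{1,\ldots,m\}$; (ii) for each $1\le i\le m$, every neighbor of $v^-_{i,i+1}$ in $G$ is $v^-_{i-1,i}$ or $v^-_{i+1,i+2}$; (iii) for each $1\le i\le m$, every neighbor of $v^+_{i,i+1}$ in $G$ is $v^+_{i-1,i}$ or $v^+_{i+1,i+2}$.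
   Context: All graphs and digraphs are simple (no loops, no multiple arcs). In a digraph $D$, if $(u,x)$ is an arc then $x$ is a prey of $u$ and $u$ is a predator of $x$. The CCE graph $CCE(D)$ of $D$ is the graph on $V(D)$ in which distinct $u,v$ are adjacent iff they have a common prey and a common predator in $D$. A $\langle 2,2\rangle$ digraph is a digraph in which every vertex has indegree at most $2$ and outdegree at most $2$. In this setting, for a path $v_1\cdots v_m$ ($m\ge3$) in $G$ and $1\le i\le m-1$, or a cycle $v_1\cdots v_mv_1$ in $G$ and $1\le i\le m$ (with $v_{m+j}=v_j$), the vertices $v_i,v_{i+1}$ have exactly one common prey and exactly one common predator in $D$, denoted $v^+_{i,i+1}$ and $v^-_{i,i+1}$ respectively. -}

module Defs where

open import Data.Nat using (ℕ; suc; _+_; _∸_; _≤_)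
open import Data.Fin using (Fin)
open import Data.Bool using (Bool; true; false; T)
open import Data.List using (length; filterᵇ)
open import Data.Product using (_×_; ∃-syntax)
open import Relation.Binary.PropositionalEquality using (_≡_; _≢_)
open import Data.Sum using (_⊎_)
open import Data.List using (List)
import Data.List.Base

allFin : (n : ℕ) → List (Fin n)
allFin n = Data.List.Base.allFin n

-- A simple digraph on the vertex set Fin n: arc u x = true means (u,x) is an arc.
-- No loops.  (Multiple arcs are impossible with a Boolean adjacency.)
record Digraph (n : ℕ) : Set where
  field
    arc      : Fin n → Fin n → Bool
    loopless : ∀ v → arc v v ≡ false
open Digraph public

Arc : ∀ {n} → Digraph n → Fin n → Fin n → Set
Arc D u x = arc D u x ≡ true

outdeg indeg : ∀ {n} → Digraph n → Fin n → ℕ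
outdeg {n} D u = length (filterᵇ (λ x → arc D u x) (allFin n))
indeg  {n} D x = length (filterᵇ (λ u → arc D u x) (allFin n))

Is22 : ∀ {n} → Digraph n → Set
Is22 D = ∀ v → (indeg D v ≤ 2) × (outdeg D v ≤ 2)

CommonPrey : ∀ {n} → Digraph n → Fin n → Fin n → Fin n → Set
CommonPrey D x u v = Arc D u x × Arc D v x

CommonPred : ∀ {n} → Digraph n → Fin n → Fin n → Fin n → Set
CommonPred D y u v = Arc D y u × Arc D y v

CCEAdj : ∀ {n} → Digraph n → Fin n → Fin n → Set
CCEAdj D u v = (u ≢ v) × (∃[ x ] CommonPrey D x u v) × (∃[ y ] CommonPred D y u v)

IsPath : ∀ {n} → Digraph n → ℕ → (ℕ → Fin n) → Set
IsPath D m v =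
  (∀ i j → 1 ≤ i → i ≤ m → 1 ≤ j → j ≤ m → v i ≡ v j → i ≡ j)
  × (∀ i → 1 ≤ i → suc i ≤ m → CCEAdj D (v i) (v (suc i)))

-- v₁ v₂ ⋯ v_m v₁ is a cycle in CCE(D); v is the m-periodic extension
-- (indices are taken modulo m)
IsCycle : ∀ {n} → Digraph n → ℕ → (ℕ → Fin n) → Set
IsCycle D m v =
  (∀ i → v (i + m) ≡ v i)
  × (∀ i j → 1 ≤ i → i ≤ m → 1 ≤ j → j ≤ m → v i ≡ v j → i ≡ j)
  × (∀ i → CCEAdj D (v i) (v (suc i)))

-- In a ⟨2,2⟩ digraph a vertex has at most two preys, so it is a common predator of at most
-- one unordered pair of distinct vertices; dually for common preys.  Consecutive edges of a
-- path or cycle (m ≥ 3) span different pairs, which gives (i).  For (ii), a CCE-neighbour w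
-- of the common predator x of v_i v_(i+1) shares a prey z with x; z is v_i or v_(i+1), whose
-- only predators are x and the common predator of the neighbouring edge, so w is the latter.
-- Reversing all arcs exchanges (ii) and (iii), so it suffices to argue for an arbitrary
-- relation R in which every element has at most two images and at most two preimages.
module Submission where

open import Defs
open import Data.Nat using (ℕ; zero; suc; _+_; _∸_; _≤_; _<_; _≤?_; z≤n; s≤s)
open import Data.Nat.Properties
  using (≤-refl; ≤-trans; <⇒≤; <⇒≢; ≰⇒>; 1+n≰n; <-cmp; m≤n⇒m<n∨m≡n; m≤n+m; n<1+n; m<n⇒m<1+n)
open import Data.Fin using (Fin; zero; suc)
open import Data.Fin.Properties using (pigeonhole; _≟_) renaming (<⇒≢ to <⇒≢ᶠ)
open import Data.Bool using (Bool; true; T?)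
open import Data.Bool.Properties using (T-≡)
open import Data.List using (List; length; lookup; filterᵇ)
open import Data.List.Membership.Propositional using (_∈_)
open import Data.List.Membership.Propositional.Properties using (∈-filter⁺; ∈-allFin)
open import Data.List.Relation.Unary.Any using (index)
open import Data.List.Relation.Unary.Any.Properties using (lookup-index)
open import Data.Product using (_×_; _,_; proj₁; proj₂)
open import Data.Sum using (_⊎_; inj₁; inj₂)
open import Function using (Injective; Equivalence; _∘_; flip)
open import Relation.Nullary using (¬_; yes; no; contradiction)
open import Relation.Binary using (tri<; tri≈; tri>)
open import Relation.Binary.PropositionalEquality using (_≡_; _≢_; refl; sym; trans; cong; subst; ≢-sym)

injection⇒≤length : ∀ {A : Set} {k} (xs : List A) (f : Fin k → A) →
                    Injective _≡_ _≡_ f → (∀ i → f i ∈ xs) → k ≤ length xs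
injection⇒≤length {k = k} xs f f-injective f∈xs with k ≤? length xs
... | yes k≤len = k≤len
... | no k≰len with pigeonhole (≰⇒> k≰len) (index ∘ f∈xs)
...   | i , j , i<j , same-index = contradiction (f-injective fi≡fj) (<⇒≢ᶠ i<j)
  where
  fi≡fj : f i ≡ f j
  fi≡fj = trans (lookup-index (f∈xs i))
                (trans (cong (lookup xs) same-index) (sym (lookup-index (f∈xs j))))

three-distinct⇒3≤length : ∀ {A : Set} {xs : List A} {a b c} →
                          a ≢ b → a ≢ c → b ≢ c → a ∈ xs → b ∈ xs → c ∈ xs → 3 ≤ length xs
three-distinct⇒3≤length {A} {xs} {a} {b} {c} a≢b a≢c b≢c a∈xs b∈xs c∈xs =
  injection⇒≤length xs f f-injective f∈xs
  where
  f : Fin 3 → A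
  f zero             = a
  f (suc zero)       = b
  f (suc (suc zero)) = c

  f∈xs : ∀ i → f i ∈ xs
  f∈xs zero             = a∈xs
  f∈xs (suc zero)       = b∈xs
  f∈xs (suc (suc zero)) = c∈xs

  f-injective : Injective _≡_ _≡_ f
  f-injective {zero}           {zero}           _ = refl
  f-injective {zero}           {suc zero}       e = contradiction e a≢b
  f-injective {zero}           {suc (suc zero)} e = contradiction e a≢c
  f-injective {suc zero}       {zero}           e = contradiction (sym e) a≢b
  f-injective {suc zero}       {suc zero}       _ = refl
  f-injective {suc zero}       {suc (suc zero)} e = contradiction e b≢c
  f-injective {suc (suc zero)} {zero}           e = contradiction (sym e) a≢c
  f-injective {suc (suc zero)} {suc zero}       e = contradiction (sym e) b≢c
  f-injective {suc (suc zero)} {suc (suc zero)} _ = refl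

AtMostTwoImages : {A : Set} → (A → A → Set) → Set
AtMostTwoImages R = ∀ {x a b c} → R x a → R x b → R x c → a ≢ b → c ≡ a ⊎ c ≡ b

count≤2⇒at-most-two-true : ∀ {n} (p : Fin n → Bool) → length (filterᵇ p (allFin n)) ≤ 2 →
                           ∀ {a b c} → p a ≡ true → p b ≡ true → p c ≡ true → a ≢ b → c ≡ a ⊎ c ≡ b
count≤2⇒at-most-two-true {n} p count≤2 {a} {b} {c} pa pb pc a≢b with c ≟ a | c ≟ b
... | yes c≡a | _       = inj₁ c≡a
... | no _    | yes c≡b = inj₂ c≡b
... | no c≢a  | no c≢b  = contradiction (≤-trans 3≤count count≤2) 1+n≰n
  where
  ∈-filter : ∀ {x} → p x ≡ true → x ∈ filterᵇ p (allFin n)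
  ∈-filter {x} px = ∈-filter⁺ (T? ∘ p) (∈-allFin x) (Equivalence.from T-≡ px)

  3≤count : 3 ≤ length (filterᵇ p (allFin n))
  3≤count = three-distinct⇒3≤length a≢b (c≢a ∘ sym) (c≢b ∘ sym) (∈-filter pa) (∈-filter pb) (∈-filter pc)

SameUnorderedPair : {A : Set} → A → A → A → A → Set
SameUnorderedPair a b c d = (c ≡ a × d ≡ b) ⊎ (c ≡ b × d ≡ a)

SameUnorderedPair-sym : {A : Set} {a b c d : A} → SameUnorderedPair a b c d → SameUnorderedPair c d a b
SameUnorderedPair-sym (inj₁ (c≡a , d≡b)) = inj₁ (sym c≡a , sym d≡b)
SameUnorderedPair-sym (inj₂ (c≡b , d≡a)) = inj₂ (sym d≡a , sym c≡b)

module AtMostTwoBothWays {A : Set} (R : A → A → Set)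
         (images : AtMostTwoImages R) (sources : AtMostTwoImages (flip R)) where

  Common : A → A → A → Set
  Common x a b = R x a × R x b

  common-source⇒same-pair : ∀ {x a b c d} → Common x a b → a ≢ b → Common x c d → c ≢ d →
                            SameUnorderedPair a b c d
  common-source⇒same-pair (xa , xb) a≢b (xc , xd) c≢d with images xa xb xc a≢b | images xa xb xd a≢b
  ... | inj₁ c≡a | inj₁ d≡a = contradiction (trans c≡a (sym d≡a)) c≢d
  ... | inj₁ c≡a | inj₂ d≡b = inj₁ (c≡a , d≡b)
  ... | inj₂ c≡b | inj₁ d≡a = inj₂ (c≡b , d≡a)
  ... | inj₂ c≡b | inj₂ d≡b = contradiction (trans c≡b (sym d≡b)) c≢d

  distinct-pairs⇒distinct-sources : ∀ {a b c d} → a ≢ b → c ≢ d → ¬ SameUnorderedPair a b c d →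
                                    ∀ x y → Common x a b → Common y c d → x ≢ y
  distinct-pairs⇒distinct-sources a≢b c≢d ¬same x .x xab xcd refl =
    ¬same (common-source⇒same-pair xab a≢b xcd c≢d)

  overlapping-pairs⇒distinct-sources : ∀ {a x p q r} → Common a p q → Common x q r →
                                       p ≢ q → p ≢ r → q ≢ r → a ≢ x
  overlapping-pairs⇒distinct-sources (ap , aq) (_ , ar) p≢q p≢r q≢r refl with images ap aq ar p≢q
  ... | inj₁ r≡p = p≢r (sym r≡p)
  ... | inj₂ r≡q = q≢r (sym r≡q)

  third-source : ∀ {a x w u} → R a u → R x u → R w u → a ≢ x → w ≢ x → w ≡ a
  third-source au xu wu a≢x w≢x with sources au xu wu a≢x
  ... | inj₁ w≡a = w≡a
  ... | inj₂ w≡x = contradiction w≡x w≢x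

  source-neighbour : ∀ {a x b u₀ u₁ u₂ u₃ w z} →
    Common a u₀ u₁ → Common x u₁ u₂ → Common b u₂ u₃ →
    u₀ ≢ u₁ → u₁ ≢ u₂ → u₂ ≢ u₃ → u₀ ≢ u₂ → u₁ ≢ u₃ →
    x ≢ w → R x z → R w z → Common w u₀ u₁ ⊎ Common w u₂ u₃
  source-neighbour {a = a} {b = b} {u₀ = u₀} {u₁} {u₂} {u₃} {w} aU xU bU u₀≢u₁ u₁≢u₂ u₂≢u₃ u₀≢u₂ u₁≢u₃ x≢w xz wz
    with images (proj₁ xU) (proj₂ xU) xz u₁≢u₂
  ... | inj₁ refl = inj₁ (subst (λ s → Common s u₀ u₁) (sym w≡a) aU)
    where
    w≡a : w ≡ a
    w≡a = third-source (proj₂ aU) (proj₁ xU) wz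
            (overlapping-pairs⇒distinct-sources aU xU u₀≢u₁ u₀≢u₂ u₁≢u₂) (≢-sym x≢w)
  ... | inj₂ refl = inj₂ (subst (λ s → Common s u₂ u₃) (sym w≡b) bU)
    where
    w≡b : w ≡ b
    w≡b = third-source (proj₁ bU) (proj₂ xU) wz
            (≢-sym (overlapping-pairs⇒distinct-sources xU bU u₁≢u₂ u₁≢u₃ u₂≢u₃)) (≢-sym x≢w)

≤∸2⇒2+≤ : ∀ m {i} → 1 ≤ i → i ≤ m ∸ 2 → 2 + i ≤ m
≤∸2⇒2+≤ (suc (suc m)) _   i≤m = s≤s (s≤s i≤m)
≤∸2⇒2+≤ (suc zero)    1≤i i≤0 = contradiction (≤-trans 1≤i i≤0) λ ()
≤∸2⇒2+≤ zero          1≤i i≤0 = contradiction (≤-trans 1≤i i≤0) λ ()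

n≢2+n : ∀ n → n ≢ 2 + n
n≢2+n n = <⇒≢ (m<n⇒m<1+n (n<1+n n))

InjectiveOn : {A : Set} → (ℕ → A) → ℕ → Set
InjectiveOn v m = ∀ i j → 1 ≤ i → i ≤ m → 1 ≤ j → j ≤ m → v i ≡ v j → i ≡ j

injective⇒two-apart : ∀ {A : Set} {v : ℕ → A} {m k} → InjectiveOn v m →
                      1 ≤ k → 2 + k ≤ m → v k ≢ v (2 + k)
injective⇒two-apart {k = k} inj 1≤k 2+k≤m vk≡v2+k =
  n≢2+n k (inj k (2 + k) 1≤k (≤-trans (m≤n+m k 2) 2+k≤m) (s≤s z≤n) 2+k≤m vk≡v2+k)

-- Near the end of the period, periodicity moves 2 + k back to 1 or 2, and injectivity then forces m ≡ 2.
periodic-injective⇒two-apart : ∀ {A : Set} {v : ℕ → A} {m} → (∀ i → v (i + m) ≡ v i) → InjectiveOn v m →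
                               3 ≤ m → ∀ {k} → k ≤ m → v k ≢ v (2 + k)
periodic-injective⇒two-apart {m = m} per inj 3≤m {zero} _ v0≡v2 =
  <⇒≢ 3≤m (sym (inj m 2 (≤-trans (s≤s z≤n) 3≤m) ≤-refl (s≤s z≤n) (<⇒≤ 3≤m) (trans (per 0) v0≡v2)))
periodic-injective⇒two-apart per inj 3≤m {suc k} 1+k≤m e with m≤n⇒m<n∨m≡n 1+k≤m
... | inj₂ refl = <⇒≢ 3≤m (sym (inj (suc k) 2 (s≤s z≤n) ≤-refl (s≤s z≤n) (<⇒≤ 3≤m) (trans e (per 2))))
... | inj₁ 2+k≤m with m≤n⇒m<n∨m≡n 2+k≤m
...   | inj₁ 3+k≤m = injective⇒two-apart inj (s≤s z≤n) 3+k≤m e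
...   | inj₂ refl  = <⇒≢ 3≤m (sym (cong suc (inj (suc k) 1 (s≤s z≤n) 1+k≤m (s≤s z≤n) (s≤s z≤n) (trans e (per 1)))))

injective⇒edges-differ : ∀ {A : Set} {v : ℕ → A} {m i j} → InjectiveOn v m →
  1 ≤ i → i < j → j ≤ m → v i ≢ v (2 + i) →
  ¬ SameUnorderedPair (v i) (v (suc i)) (v j) (v (suc j))
injective⇒edges-differ {i = i} {j} inj 1≤i i<j j≤m _ (inj₁ (vj≡vi , _)) =
  <⇒≢ i<j (sym (inj j i (≤-trans 1≤i (<⇒≤ i<j)) j≤m 1≤i (≤-trans (<⇒≤ i<j) j≤m) vj≡vi))
injective⇒edges-differ {i = i} {j} inj 1≤i i<j j≤m vi≢v2+i (inj₂ (vj≡v1+i , v1+j≡vi))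
  with inj j (suc i) (≤-trans 1≤i (<⇒≤ i<j)) j≤m (s≤s z≤n) (≤-trans i<j j≤m) vj≡v1+i
... | refl = vi≢v2+i (sym v1+j≡vi)

module CCE {n} (D : Digraph n) (d : Is22 D) where

  preys-at-most-two : AtMostTwoImages (Arc D)
  preys-at-most-two {x} = count≤2⇒at-most-two-true (arc D x) (proj₂ (d x))

  predators-at-most-two : AtMostTwoImages (flip (Arc D))
  predators-at-most-two {x} = count≤2⇒at-most-two-true (λ u → arc D u x) (proj₁ (d x))

  -- Pred.Common is CommonPred D and Prey.Common is CommonPrey D, definitionally.
  module Pred = AtMostTwoBothWays (Arc D) preys-at-most-two predators-at-most-two
  module Prey = AtMostTwoBothWays (flip (Arc D)) predators-at-most-two preys-at-most-two

  -- The witnesses of an edge v_i v_(i+1) of CCE(D) are its common predators and preys (v⁻, v⁺).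
  WitnessesDistinct : (ℕ → Fin n) → ℕ → ℕ → Set
  WitnessesDistinct v i j =
    (∀ x y → CommonPred D x (v i) (v (suc i)) → CommonPred D y (v j) (v (suc j)) → x ≢ y)
    × (∀ x y → CommonPrey D x (v i) (v (suc i)) → CommonPrey D y (v j) (v (suc j)) → x ≢ y)

  WitnessNeighbours : (ℕ → Fin n) → ℕ → Set
  WitnessNeighbours v i =
    (∀ x → CommonPred D x (v i) (v (suc i)) → ∀ w → CCEAdj D x w →
      CommonPred D w (v (i ∸ 1)) (v i) ⊎ CommonPred D w (v (suc i)) (v (suc (suc i))))
    × (∀ x → CommonPrey D x (v i) (v (suc i)) → ∀ w → CCEAdj D x w →
      CommonPrey D w (v (i ∸ 1)) (v i) ⊎ CommonPrey D w (v (suc i)) (v (suc (suc i))))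

  witnesses-distinct : ∀ v {i j} → CCEAdj D (v i) (v (suc i)) → CCEAdj D (v j) (v (suc j)) →
    ¬ SameUnorderedPair (v i) (v (suc i)) (v j) (v (suc j)) → WitnessesDistinct v i j
  witnesses-distinct _ (vi≢ , _) (vj≢ , _) ¬same =
    Pred.distinct-pairs⇒distinct-sources vi≢ vj≢ ¬same ,
    Prey.distinct-pairs⇒distinct-sources vi≢ vj≢ ¬same

  witness-neighbours : ∀ v k →
    CCEAdj D (v k) (v (1 + k)) → CCEAdj D (v (1 + k)) (v (2 + k)) → CCEAdj D (v (2 + k)) (v (3 + k)) →
    v k ≢ v (2 + k) → v (1 + k) ≢ v (3 + k) → WitnessNeighbours v (suc k)
  witness-neighbours _ _ (≢₀₁ , (_ , prey₀₁) , (_ , pred₀₁)) (≢₁₂ , _) (≢₂₃ , (_ , prey₂₃) , (_ , pred₂₃)) ≢₀₂ ≢₁₃ =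
    (λ { x pred w (x≢w , (_ , xz , wz) , _) →
      Pred.source-neighbour pred₀₁ pred pred₂₃ ≢₀₁ ≢₁₂ ≢₂₃ ≢₀₂ ≢₁₃ x≢w xz wz }) ,
    (λ { x prey w (x≢w , _ , (_ , zx , zw)) →
      Prey.source-neighbour prey₀₁ prey prey₂₃ ≢₀₁ ≢₁₂ ≢₂₃ ≢₀₂ ≢₁₃ x≢w zx zw })

  module _ {m : ℕ} {v : ℕ → Fin n} where

    path-witnesses-distinct : IsPath D m v → ∀ i j → 1 ≤ i → suc i ≤ m → 1 ≤ j → suc j ≤ m → i ≢ j →
                              WitnessesDistinct v i j
    path-witnesses-distinct (inj , adj) i j 1≤i i<m 1≤j j<m i≢j with <-cmp i j
    ... | tri< i<j _ _ = witnesses-distinct v (adj i 1≤i i<m) (adj j 1≤j j<m)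
            (injective⇒edges-differ inj 1≤i i<j (<⇒≤ j<m)
              (injective⇒two-apart inj 1≤i (≤-trans (s≤s i<j) j<m)))
    ... | tri≈ _ i≡j _ = contradiction i≡j i≢j
    ... | tri> _ _ j<i = witnesses-distinct v (adj i 1≤i i<m) (adj j 1≤j j<m)
            (injective⇒edges-differ inj 1≤j j<i (<⇒≤ i<m)
              (injective⇒two-apart inj 1≤j (≤-trans (s≤s j<i) i<m)) ∘ SameUnorderedPair-sym)

    path-witness-neighbours : IsPath D m v → ∀ i → 2 ≤ i → i ≤ m ∸ 2 → WitnessNeighbours v i
    path-witness-neighbours (inj , adj) (suc k) (s≤s 1≤k) 1+k≤m∸2 =
      witness-neighbours v k (adj k 1≤k (<⇒≤ 2+k≤m)) (adj (1 + k) (s≤s z≤n) 2+k≤m) (adj (2 + k) (s≤s z≤n) 3+k≤m)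
        (injective⇒two-apart inj 1≤k 2+k≤m) (injective⇒two-apart inj (s≤s z≤n) 3+k≤m)
      where
      3+k≤m : 3 + k ≤ m
      3+k≤m = ≤∸2⇒2+≤ m (s≤s z≤n) 1+k≤m∸2

      2+k≤m : 2 + k ≤ m
      2+k≤m = <⇒≤ 3+k≤m

    cycle-witnesses-distinct : IsCycle D m v → 3 ≤ m → ∀ i j → 1 ≤ i → i ≤ m → 1 ≤ j → j ≤ m → i ≢ j →
                               WitnessesDistinct v i j
    cycle-witnesses-distinct (per , inj , adj) 3≤m i j 1≤i i≤m 1≤j j≤m i≢j with <-cmp i j
    ... | tri< i<j _ _ = witnesses-distinct v (adj i) (adj j)
            (injective⇒edges-differ inj 1≤i i<j j≤m (periodic-injective⇒two-apart per inj 3≤m i≤m))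
    ... | tri≈ _ i≡j _ = contradiction i≡j i≢j
    ... | tri> _ _ j<i = witnesses-distinct v (adj i) (adj j)
            (injective⇒edges-differ inj 1≤j j<i i≤m (periodic-injective⇒two-apart per inj 3≤m j≤m)
              ∘ SameUnorderedPair-sym)

    cycle-witness-neighbours : IsCycle D m v → 3 ≤ m → ∀ i → 1 ≤ i → i ≤ m → WitnessNeighbours v i
    cycle-witness-neighbours (per , inj , adj) 3≤m (suc k) _ 1+k≤m =
      witness-neighbours v k (adj k) (adj (1 + k)) (adj (2 + k))
        (periodic-injective⇒two-apart per inj 3≤m (<⇒≤ 1+k≤m))
        (periodic-injective⇒two-apart per inj 3≤m 1+k≤m)

proposition2p6 : ∀ {n} (D : Digraph n) → Is22 D → (m : ℕ) → 3 ≤ m → (v : ℕ → Fin n) →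
    (IsPath D m v →
      (∀ i j → 1 ≤ i → suc i ≤ m → 1 ≤ j → suc j ≤ m → i ≢ j →
        (∀ x y → CommonPred D x (v i) (v (suc i)) → CommonPred D y (v j) (v (suc j)) → x ≢ y)
        × (∀ x y → CommonPrey D x (v i) (v (suc i)) → CommonPrey D y (v j) (v (suc j)) → x ≢ y))
      × (∀ i → 2 ≤ i → i ≤ m ∸ 2 → ∀ x → CommonPred D x (v i) (v (suc i)) →
          ∀ w → CCEAdj D x w →
          CommonPred D w (v (i ∸ 1)) (v i) ⊎ CommonPred D w (v (suc i)) (v (suc (suc i))))
      × (∀ i → 2 ≤ i → i ≤ m ∸ 2 → ∀ x → CommonPrey D x (v i) (v (suc i)) →
          ∀ w → CCEAdj D x w →
          CommonPrey D w (v (i ∸ 1)) (v i) ⊎ CommonPrey D w (v (suc i)) (v (suc (suc i)))))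
    ×
    (IsCycle D m v →
      (∀ i j → 1 ≤ i → i ≤ m → 1 ≤ j → j ≤ m → i ≢ j →
        (∀ x y → CommonPred D x (v i) (v (suc i)) → CommonPred D y (v j) (v (suc j)) → x ≢ y)
        × (∀ x y → CommonPrey D x (v i) (v (suc i)) → CommonPrey D y (v j) (v (suc j)) → x ≢ y))
      × (∀ i → 1 ≤ i → i ≤ m → ∀ x → CommonPred D x (v i) (v (suc i)) →
          ∀ w → CCEAdj D x w →
          CommonPred D w (v (i ∸ 1)) (v i) ⊎ CommonPred D w (v (suc i)) (v (suc (suc i))))
      × (∀ i → 1 ≤ i → i ≤ m → ∀ x → CommonPrey D x (v i) (v (suc i)) →
          ∀ w → CCEAdj D x w →
          CommonPrey D w (v (i ∸ 1)) (v i) ⊎ CommonPrey D w (v (suc i)) (v (suc (suc i)))))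
proposition2p6 D d m 3≤m v =
  (λ P → path-witnesses-distinct P ,
         (λ i 2≤i i≤m∸2 → proj₁ (path-witness-neighbours P i 2≤i i≤m∸2)) ,
         (λ i 2≤i i≤m∸2 → proj₂ (path-witness-neighbours P i 2≤i i≤m∸2))) ,
  (λ C → cycle-witnesses-distinct C 3≤m ,
         (λ i 1≤i i≤m → proj₁ (cycle-witness-neighbours C 3≤m i 1≤i i≤m)) ,
         (λ i 1≤i i≤m → proj₂ (cycle-witness-neighbours C 3≤m i 1≤i i≤m)))
  where open CCE D d
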